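{- Let $(P,N)$ be an NN representation of a Boolean function $f:\{0,1\}^n\to\{0,1\}$ of size at least $2$, and let $a\in P$ and $b\in N$. Let $\mathcal{X}$ be the set of $X\in\{0,1\}^n$ for which $a$ is a nearest anchor (among $P\cup N$), and $\mathcal{Y}$ the set of $X\in\{0,1\}^n$ for which $b$ is a nearest anchor. Then $\mathrm{conv}(\mathcal{X})\cap\mathrm{conv}(\mathcal{Y})=\emptyset$, where $\mathrm{conv}$ denotes convex hull.
   Context: $d$ is Euclidean distance. An NN representation of $f$ is a pair of disjoint finite sets $P,N\subset\mathbb{R}^n$ (positive and negative anchors) such that for every $X$ with $f(X)=1$ there is $p\in P$ with $d(X,p)<d(X,q)$ for all $q\in N$, and for every $X$ with $f(X)=0$ there is $q\in N$ with $d(X,q)<d(X,p)$ for all $p\in P$. Its size is $|P\cup N|$. -}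

module Defs where

open import Level using (Level; _⊔_) renaming (suc to lsuc)
open import Data.Nat using (ℕ)
open import Data.Fin using (Fin; zero; suc)
open import Data.Bool using (Bool; true; false)
open import Data.List using (List; _++_)
open import Data.List.Membership.Propositional using (_∈_)
open import Data.Product using (Σ; _×_; ∃; ∃-syntax)
open import Data.Sum using (_⊎_)
open import Relation.Nullary using (¬_)
open import Relation.Binary.PropositionalEquality using (_≡_)
open import Relation.Binary.Structures using (IsStrictTotalOrder)
open import Algebra.Bundles using (CommutativeRing)

-- An ordered field: a commutative ring with a strict total order compatible
-- with + and *, in which every nonzero element has a multiplicative inverse.
-- (ℝ is an instance; we state the result for every ordered field.)
record OrderedField (c ℓ ℓ' : Level) : Set (lsuc (c ⊔ ℓ ⊔ ℓ')) where
  field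
    commutativeRing : CommutativeRing c ℓ
  open CommutativeRing commutativeRing public
  field
    _<_                : Carrier → Carrier → Set ℓ'
    isStrictTotalOrder : IsStrictTotalOrder _≈_ _<_
    +-mono-<           : ∀ {x y} z → x < y → (x + z) < (y + z)
    *-pos              : ∀ {x y} → 0# < x → 0# < y → 0# < (x * y)
    0≉1                : ¬ (0# ≈ 1#)
    inverse            : ∀ x → ¬ (x ≈ 0#) → ∃[ y ] (x * y ≈ 1#)

  _≤_ : Carrier → Carrier → Set (ℓ ⊔ ℓ')
  x ≤ y = (x < y) ⊎ (x ≈ y)

module _ {c ℓ ℓ'} (F : OrderedField c ℓ ℓ') where
  open OrderedField F hiding (zero)

  Point : ℕ → Set c
  Point n = Fin n → Carrier

  sumF : ∀ {k} → (Fin k → Carrier) → Carrier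
  sumF {ℕ.zero} g = 0#
  sumF {ℕ.suc k} g = g zero + sumF (λ j → g (suc j))

  dist² : ∀ {n} → Point n → Point n → Carrier
  dist² x y = sumF (λ i → (x i - y i) * (x i - y i))

  bit : Bool → Carrier
  bit true  = 1#
  bit false = 0#

  emb : ∀ {n} → (Fin n → Bool) → Point n
  emb X i = bit (X i)

  _≈ᵖ_ : ∀ {n} → Point n → Point n → Set ℓ
  p ≈ᵖ q = ∀ i → p i ≈ q i

  Disjoint : ∀ {n} → List (Point n) → List (Point n) → Set (c ⊔ ℓ)
  Disjoint P N = ∀ {p q} → p ∈ P → q ∈ N → ¬ (p ≈ᵖ q)

  -- NN representation (distances compared via squared Euclidean distance,
  -- equivalent to comparing Euclidean distances)
  IsNNRep : ∀ {n} → ((Fin n → Bool) → Bool) → List (Point n) → List (Point n)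
            → Set (c ⊔ ℓ ⊔ ℓ')
  IsNNRep {n} f P N =
    Disjoint P N ×
    (∀ (X : Fin n → Bool) →
      (f X ≡ true  → ∃[ p ] (p ∈ P × (∀ {q} → q ∈ N → dist² (emb X) p < dist² (emb X) q))) ×
      (f X ≡ false → ∃[ q ] (q ∈ N × (∀ {p} → p ∈ P → dist² (emb X) q < dist² (emb X) p))))

  NearestAnchor : ∀ {n} → List (Point n) → Point n → (Fin n → Bool) → Set (c ⊔ ℓ ⊔ ℓ')
  NearestAnchor A a X = ∀ {c'} → c' ∈ A → dist² (emb X) a ≤ dist² (emb X) c'

  InConvHull : ∀ {n} {s} → ((Fin n → Bool) → Set s) → Point n → Set (c ⊔ ℓ ⊔ ℓ' ⊔ s)
  InConvHull {n} S Z =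
    Σ ℕ λ k → Σ (Fin k → (Fin n → Bool)) λ xs → Σ (Fin k → Carrier) λ λs →
      ((∀ (j : Fin k) → S (xs j)) ×
       (∀ j → 0# ≤ λs j) ×
       (sumF λs ≈ 1#) ×
       (∀ (i : Fin n) → Z i ≈ sumF (λ j → λs j * emb {n} (xs j) i)))

-- The map x ↦ d²(x, b) − d²(x, a) is affine, so the set of points strictly nearer to a than
-- to b is closed under convex combinations. Because the anchors classify every input
-- strictly, each vertex of 𝒳 is strictly nearer to a than to b and each vertex of 𝒴 strictly
-- nearer to b than to a; a common point of both hulls would then be strictly nearer to each.
module Submission where

open import Defs
open import Data.Nat using (ℕ; zero; suc)
open import Data.Fin using (Fin)
open import Data.Bool using (Bool; true; false)
open import Data.List using (List; _++_)
open import Data.List.Membership.Propositional using (_∈_)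
open import Data.List.Membership.Propositional.Properties using (∈-++⁺ˡ; ∈-++⁺ʳ)
open import Data.Product using (_×_; _,_; proj₂)
open import Data.Sum using (_⊎_; inj₁; inj₂)
open import Data.Empty using (⊥-elim)
open import Function using (_∘_)
open import Relation.Nullary using (¬_)
open import Relation.Binary.PropositionalEquality as ≡ using (_≡_)
open import Relation.Binary.Structures using (IsStrictTotalOrder)
import Algebra.Properties.CommutativeSemigroup as CommutativeSemigroupProperties
import Algebra.Properties.Group as GroupProperties
import Algebra.Properties.Semiring.Sum as SemiringSum
import Algebra.Solver.Ring.NaturalCoefficients.Default as SemiringSolver
import Relation.Binary.Reasoning.Setoid as SetoidReasoning

module _ {c ℓ ℓ'} (F : OrderedField c ℓ ℓ') where
  open OrderedField F hiding (zero)
  open IsStrictTotalOrder isStrictTotalOrder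
    using (irrefl; <-respˡ-≈; <-respʳ-≈) renaming (trans to <-trans)
  open CommutativeSemigroupProperties *-commutativeSemigroup using (x∙yz≈y∙xz)
  open GroupProperties +-group using (//-rightDividesʳ)
  open SemiringSum semiring using (sum; sum-cong-≋; ∑-distrib-+; ∑-comm; *-distribˡ-sum; *-distribʳ-sum)
  open SemiringSolver commutativeSemiring using (solve; _:+_; _:*_; _:=_)
  open SetoidReasoning setoid

  sumF≡sum : ∀ {k} (g : Fin k → Carrier) → sumF F g ≡ sum g
  sumF≡sum {zero}  g = ≡.refl
  sumF≡sum {suc k} g = ≡.cong (g Fin.zero +_) (sumF≡sum (g ∘ Fin.suc))

  ≤-<-trans : ∀ {x y z} → x ≤ y → y < z → x < z
  ≤-<-trans (inj₁ x<y) y<z = <-trans x<y y<z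
  ≤-<-trans (inj₂ x≈y) y<z = <-respˡ-≈ (sym x≈y) y<z

  +-cancelʳ-< : ∀ {x y} z → (x + z) < (y + z) → x < y
  +-cancelʳ-< {x} {y} z x+z<y+z =
    <-respʳ-≈ (//-rightDividesʳ z y) (<-respˡ-≈ (//-rightDividesʳ z x) (+-mono-< (- z) x+z<y+z))

  0<x⇒y<x+y : ∀ {x} y → 0# < x → y < (x + y)
  0<x⇒y<x+y y 0<x = <-respˡ-≈ (+-identityˡ y) (+-mono-< y 0<x)

  y<x+y⇒0<x : ∀ {x y} → y < (x + y) → 0# < x
  y<x+y⇒0<x {y = y} y<x+y = +-cancelʳ-< y (<-respˡ-≈ (sym (+-identityˡ y)) y<x+y)

  +-pos : ∀ {x y} → 0# < x → 0# < y → 0# < (x + y)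
  +-pos {y = y} 0<x 0<y = <-trans 0<y (0<x⇒y<x+y y 0<x)

  0≈x⇒x*y≈0 : ∀ {x} y → 0# ≈ x → x * y ≈ 0#
  0≈x⇒x*y≈0 y 0≈x = trans (*-congʳ (sym 0≈x)) (zeroˡ y)

  weighted-sum-pos-or-null : ∀ {k} (ws g : Fin k → Carrier) →
    (∀ j → 0# ≤ ws j) → (∀ j → 0# < g j) →
    0# < sum (λ j → ws j * g j) ⊎ (sum ws ≈ 0# × sum (λ j → ws j * g j) ≈ 0#)
  weighted-sum-pos-or-null {zero} ws g _ _ = inj₂ (refl , refl)
  weighted-sum-pos-or-null {suc k} ws g ws≥0 g>0
    with ws≥0 Fin.zero
       | weighted-sum-pos-or-null (ws ∘ Fin.suc) (g ∘ Fin.suc) (ws≥0 ∘ Fin.suc) (g>0 ∘ Fin.suc)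
  ... | inj₁ w>0 | inj₁ rest>0 = inj₁ (+-pos (*-pos w>0 (g>0 Fin.zero)) rest>0)
  ... | inj₁ w>0 | inj₂ (_ , rest≈0) =
    inj₁ (<-respʳ-≈ (sym (trans (+-congˡ rest≈0) (+-identityʳ _))) (*-pos w>0 (g>0 Fin.zero)))
  ... | inj₂ 0≈w | inj₁ rest>0 =
    inj₁ (<-respʳ-≈ (sym (trans (+-congʳ (0≈x⇒x*y≈0 (g Fin.zero) 0≈w)) (+-identityˡ _))) rest>0)
  ... | inj₂ 0≈w | inj₂ (∑ws≈0 , rest≈0) =
    inj₂ ( trans (+-cong (sym 0≈w) ∑ws≈0) (+-identityˡ 0#)
         , trans (+-cong (0≈x⇒x*y≈0 (g Fin.zero) 0≈w) rest≈0) (+-identityˡ 0#))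

  weighted-mean-pos : ∀ {k} (ws g : Fin k → Carrier) →
    (∀ j → 0# ≤ ws j) → sum ws ≈ 1# → (∀ j → 0# < g j) → 0# < sum (λ j → ws j * g j)
  weighted-mean-pos ws g ws≥0 ∑ws≈1 g>0 with weighted-sum-pos-or-null ws g ws≥0 g>0
  ... | inj₁ pos = pos
  ... | inj₂ (∑ws≈0 , _) = ⊥-elim (0≉1 (trans (sym ∑ws≈0) ∑ws≈1))

  affine : ∀ {n} (α β : Point F n) → Point F n → Carrier
  affine α β x = sum (λ i → α i * x i + β i)

  affine₁-convex-combination : ∀ {k} α β (ws t : Fin k → Carrier) → sum ws ≈ 1# →
    α * sum (λ j → ws j * t j) + β ≈ sum (λ j → ws j * (α * t j + β))
  affine₁-convex-combination α β ws t ∑ws≈1 = sym (begin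
    sum (λ j → ws j * (α * t j + β))              ≈⟨ sum-cong-≋ (λ j → distribˡ (ws j) (α * t j) β) ⟩
    sum (λ j → ws j * (α * t j) + ws j * β)       ≈⟨ ∑-distrib-+ (λ j → ws j * (α * t j)) (λ j → ws j * β) ⟩
    sum (λ j → ws j * (α * t j)) + sum (λ j → ws j * β)
      ≈⟨ +-cong (sum-cong-≋ (λ j → x∙yz≈y∙xz (ws j) α (t j))) (sym (*-distribʳ-sum β ws)) ⟩
    sum (λ j → α * (ws j * t j)) + sum ws * β     ≈⟨ +-cong (sym (*-distribˡ-sum α (λ j → ws j * t j))) (*-congʳ ∑ws≈1) ⟩
    α * sum (λ j → ws j * t j) + 1# * β           ≈⟨ +-congˡ (*-identityˡ β) ⟩
    α * sum (λ j → ws j * t j) + β                ∎)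

  affine-convex-combination : ∀ {n k} (α β : Point F n) (ws : Fin k → Carrier) (xs : Fin k → Point F n)
    (Z : Point F n) → sum ws ≈ 1# → (∀ i → Z i ≈ sum (λ j → ws j * xs j i)) →
    affine α β Z ≈ sum (λ j → ws j * affine α β (xs j))
  affine-convex-combination α β ws xs Z ∑ws≈1 Z≈ = begin
    sum (λ i → α i * Z i + β i)
      ≈⟨ sum-cong-≋ (λ i → trans (+-congʳ (*-congˡ (Z≈ i)))
                                 (affine₁-convex-combination (α i) (β i) ws (λ j → xs j i) ∑ws≈1)) ⟩
    sum (λ i → sum (λ j → ws j * (α i * xs j i + β i)))
      ≈⟨ ∑-comm (λ i j → ws j * (α i * xs j i + β i)) ⟩
    sum (λ j → sum (λ i → ws j * (α i * xs j i + β i)))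
      ≈⟨ sum-cong-≋ (λ j → sym (*-distribˡ-sum (ws j) (λ i → α i * xs j i + β i))) ⟩
    sum (λ j → ws j * affine α β (xs j)) ∎

  -- With w = a − b: (t − b)² = ((t − a) + w)² = 2w·t + (2w·(−a) + w²) + (t − a)².
  bisector-slope bisector-offset : Carrier → Carrier → Carrier
  bisector-slope a b = (a - b) + (a - b)
  bisector-offset a b = bisector-slope a b * - a + (a - b) * (a - b)

  x-z≈[x-y]+[y-z] : ∀ x y z → x - z ≈ (x - y) + (y - z)
  x-z≈[x-y]+[y-z] x y z = sym (begin
    (x - y) + (y - z)    ≈⟨ +-assoc x (- y) (y - z) ⟩
    x + (- y + (y - z))  ≈⟨ +-congˡ (sym (+-assoc (- y) y (- z))) ⟩
    x + ((- y + y) - z)  ≈⟨ +-congˡ (+-congʳ (-‿inverseˡ y)) ⟩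
    x + (0# - z)         ≈⟨ +-congˡ (+-identityˡ (- z)) ⟩
    x - z                ∎)

  square-sub-shift : ∀ t a b →
    (t - b) * (t - b) ≈ (bisector-slope a b * t + bisector-offset a b) + (t - a) * (t - a)
  square-sub-shift t a b = begin
    (t - b) * (t - b)                     ≈⟨ *-cong (x-z≈[x-y]+[y-z] t a b) (x-z≈[x-y]+[y-z] t a b) ⟩
    ((t - a) + (a - b)) * ((t - a) + (a - b))
      ≈⟨ solve 3 (λ t -a w → ((t :+ -a) :+ w) :* ((t :+ -a) :+ w)
                             := ((w :+ w) :* t :+ ((w :+ w) :* -a :+ w :* w)) :+ (t :+ -a) :* (t :+ -a))
               refl t (- a) (a - b) ⟩
    (bisector-slope a b * t + bisector-offset a b) + (t - a) * (t - a) ∎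

  dist²-gap : ∀ {n} (a b : Point F n) → Point F n → Carrier
  dist²-gap a b = affine (λ i → bisector-slope (a i) (b i)) (λ i → bisector-offset (a i) (b i))

  dist²-gap-correct : ∀ {n} (a b x : Point F n) → dist² F x b ≈ dist²-gap a b x + dist² F x a
  dist²-gap-correct a b x = begin
    dist² F x b                                          ≡⟨ sumF≡sum (λ i → (x i - b i) * (x i - b i)) ⟩
    sum (λ i → (x i - b i) * (x i - b i))                ≈⟨ sum-cong-≋ (λ i → square-sub-shift (x i) (a i) (b i)) ⟩
    sum (λ i → (bisector-slope (a i) (b i) * x i + bisector-offset (a i) (b i)) + (x i - a i) * (x i - a i))
      ≈⟨ ∑-distrib-+ (λ i → bisector-slope (a i) (b i) * x i + bisector-offset (a i) (b i))
                     (λ i → (x i - a i) * (x i - a i)) ⟩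
    dist²-gap a b x + sum (λ i → (x i - a i) * (x i - a i)) ≡⟨ ≡.cong (dist²-gap a b x +_) (≡.sym (sumF≡sum (λ i → (x i - a i) * (x i - a i)))) ⟩
    dist²-gap a b x + dist² F x a                        ∎

  nearer-convex : ∀ {n k} (a b Z : Point F n) (ws : Fin k → Carrier) (xs : Fin k → Point F n) →
    (∀ j → 0# ≤ ws j) → sum ws ≈ 1# → (∀ i → Z i ≈ sum (λ j → ws j * xs j i)) →
    (∀ j → dist² F (xs j) a < dist² F (xs j) b) → dist² F Z a < dist² F Z b
  nearer-convex a b Z ws xs ws≥0 ∑ws≈1 Z≈ xs-nearer =
    <-respʳ-≈ (sym (dist²-gap-correct a b Z)) (0<x⇒y<x+y (dist² F Z a) gap>0)
    where
    gap>0 : 0# < dist²-gap a b Z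
    gap>0 = <-respʳ-≈
      (sym (affine-convex-combination _ _ ws xs Z ∑ws≈1 Z≈))
      (weighted-mean-pos ws (dist²-gap a b ∘ xs) ws≥0 ∑ws≈1
        (λ j → y<x+y⇒0<x (<-respʳ-≈ (dist²-gap-correct a b (xs j)) (xs-nearer j))))

  nearer-in-hull : ∀ {n s} {S : (Fin n → Bool) → Set s} (a b Z : Point F n) →
    (∀ X → S X → dist² F (emb F X) a < dist² F (emb F X) b) →
    InConvHull F S Z → dist² F Z a < dist² F Z b
  nearer-in-hull a b Z S-nearer (k , xs , ws , xs∈S , ws≥0 , ∑ws≈1 , Z≈) =
    nearer-convex a b Z ws (emb F ∘ xs) ws≥0
      (trans (reflexive (≡.sym (sumF≡sum ws))) ∑ws≈1)
      (λ i → trans (Z≈ i) (reflexive (sumF≡sum (λ j → ws j * emb F (xs j) i))))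
      (λ j → S-nearer (xs j) (xs∈S j))

  nearest-closer : ∀ {n} {A : List (Point F n)} {a c d} X → NearestAnchor F A a X → c ∈ A →
    dist² F (emb F X) c < dist² F (emb F X) d → dist² F (emb F X) a < dist² F (emb F X) d
  nearest-closer X near c∈A c<d = ≤-<-trans (near c∈A) c<d

  nearest-not-farther : ∀ {n} {A : List (Point F n)} {a c} X → NearestAnchor F A a X → c ∈ A →
    ¬ (dist² F (emb F X) c < dist² F (emb F X) a)
  nearest-not-farther X near c∈A c<a = irrefl refl (nearest-closer X near c∈A c<a)

  module _ {n} {f : (Fin n → Bool) → Bool} {P N : List (Point F n)} (rep : IsNNRep F f P N)
           {a b : Point F n} (a∈P : a ∈ P) (b∈N : b ∈ N) where

    positive-nearest-closer : ∀ X → NearestAnchor F (P ++ N) a X →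
      dist² F (emb F X) a < dist² F (emb F X) b
    positive-nearest-closer X near with f X | proj₂ rep X
    ... | true | (classified , _) =
      let p , p∈P , p<N = classified ≡.refl in nearest-closer X near (∈-++⁺ˡ p∈P) (p<N b∈N)
    ... | false | (_ , classified) =
      let q , q∈N , q<P = classified ≡.refl
      in  ⊥-elim (nearest-not-farther X near (∈-++⁺ʳ P q∈N) (q<P a∈P))

    negative-nearest-closer : ∀ X → NearestAnchor F (P ++ N) b X →
      dist² F (emb F X) b < dist² F (emb F X) a
    negative-nearest-closer X near with f X | proj₂ rep X
    ... | true | (classified , _) =
      let p , p∈P , p<N = classified ≡.refl
      in  ⊥-elim (nearest-not-farther X near (∈-++⁺ˡ p∈P) (p<N b∈N))
    ... | false | (_ , classified) =
      let q , q∈N , q<P = classified ≡.refl in nearest-closer X near (∈-++⁺ʳ P q∈N) (q<P a∈P)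

proposition5 : ∀ {c ℓ ℓ'} (F : OrderedField c ℓ ℓ') (n : ℕ)
    (f : (Fin n → Bool) → Bool) (P N : List (Point F n)) →
    IsNNRep F f P N →
    (a b : Point F n) → a ∈ P → b ∈ N →
    (Z : Point F n) →
    ¬ (InConvHull F (NearestAnchor F (P ++ N) a) Z ×
    InConvHull F (NearestAnchor F (P ++ N) b) Z)
proposition5 F n f P N rep a b a∈P b∈N Z (a-hull , b-hull) =
  asym (nearer-in-hull F a b Z (positive-nearest-closer F rep a∈P b∈N) a-hull)
       (nearer-in-hull F b a Z (negative-nearest-closer F rep a∈P b∈N) b-hull)
  where open IsStrictTotalOrder (OrderedField.isStrictTotalOrder F) using (asym)
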